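{- Let $C(a,b)=a^4+36a^2b^2+432b^4$, $A(a,b)=(-3a^2-36b^2)C(a,b)$, $B(a,b)=(2a^5+72a^3b^2+864ab^4)C(a,b)$. For a prime $\ell$ let \[\mathfrak{d}_\ell:=\ell^{ -12}\,\#\{(a,b)\in(\mathbb{Z}/\ell^6\mathbb{Z})^2:\ (a,b)\not\equiv(0,0)\ (\mathrm{mod}\ \ell),\ \text{and }\big(A(a,b)\not\equiv0\ (\mathrm{mod}\ \ell^4)\text{ or }B(a,b)\not\equiv0\ (\mathrm{mod}\ \ell^6)\big)\}.\] Then for every prime $\ell\notin\{2,3\}$, \[\mathfrak{d}_\ell=1-\frac{1}{\ell^2}-\frac{r_\ell(\ell-1)}{\ell^5},\] where $r_\ell$ is the number of $t\in\mathbb{Z}/\ell\mathbb{Z}$ with $t^4+36t^2+432\equiv0\pmod{\ell}$. Moreover $\mathfrak{d}_2=\frac12$ and $\mathfrak{d}_3=\frac23$. -}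

module Defs where

open import Data.Nat as ℕ using (ℕ; _^_; NonZero)
open import Data.Nat.Properties using (m^n≢0)
open import Data.Nat.Divisibility using (_∣_; _∣?_)
open import Data.Integer as ℤ using (ℤ; +_; ∣_∣)
open import Data.Rational as ℚ using (ℚ)
open import Data.List using (List; length; filter; cartesianProduct; upTo)
open import Data.Product using (_×_; _,_; proj₁; proj₂)
open import Data.Sum using (_⊎_)
open import Relation.Nullary using (¬_; Dec)
open import Relation.Nullary.Decidable using (¬?; _×-dec_; _⊎-dec_)

Cp : ℤ → ℤ → ℤ
Cp a b = a ℤ.^ 4 ℤ.+ + 36 ℤ.* a ℤ.^ 2 ℤ.* b ℤ.^ 2 ℤ.+ + 432 ℤ.* b ℤ.^ 4

Ap : ℤ → ℤ → ℤ
Ap a b = (ℤ.- (+ 3) ℤ.* a ℤ.^ 2 ℤ.- + 36 ℤ.* b ℤ.^ 2) ℤ.* Cp a b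

Bp : ℤ → ℤ → ℤ
Bp a b = (+ 2 ℤ.* a ℤ.^ 5 ℤ.+ + 72 ℤ.* a ℤ.^ 3 ℤ.* b ℤ.^ 2 ℤ.+ + 864 ℤ.* a ℤ.* b ℤ.^ 4) ℤ.* Cp a b

_∣ℤ_ : ℕ → ℤ → Set
n ∣ℤ z = n ∣ ∣ z ∣

-- the condition on a residue pair (a,b), represented by 0 ≤ a,b < ℓ^6
Good : ℕ → ℕ × ℕ → Set
Good ℓ (a , b) =
  (¬ ((ℓ ∣ a) × (ℓ ∣ b))) ×
  (¬ ((ℓ ^ 4) ∣ℤ Ap (+ a) (+ b)) ⊎ ¬ ((ℓ ^ 6) ∣ℤ Bp (+ a) (+ b)))

good? : ∀ ℓ (p : ℕ × ℕ) → Dec (Good ℓ p)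
good? ℓ (a , b) =
  ¬? ((ℓ ∣? a) ×-dec (ℓ ∣? b)) ×-dec
  (¬? ((ℓ ^ 4) ∣? ∣ Ap (+ a) (+ b) ∣) ⊎-dec ¬? ((ℓ ^ 6) ∣? ∣ Bp (+ a) (+ b) ∣))

count : ℕ → ℕ
count ℓ = length (filter (good? ℓ) (cartesianProduct (upTo (ℓ ^ 6)) (upTo (ℓ ^ 6))))

𝔡 : (ℓ : ℕ) → .{{NonZero ℓ}} → ℚ
𝔡 ℓ = (+ count ℓ) ℚ./ (ℓ ^ 12)
  where instance _ = m^n≢0 ℓ 12

r : ℕ → ℕ
r ℓ = length (filter (λ t → ℓ ∣? (t ^ 4 ℕ.+ 36 ℕ.* t ^ 2 ℕ.+ 432)) (upTo ℓ))

rhs : (ℓ : ℕ) → .{{NonZero ℓ}} → ℚ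
rhs ℓ = ℚ.1ℚ ℚ.- (+ 1) ℚ./ (ℓ ^ 2) ℚ.- (+ (r ℓ ℕ.* (ℓ ℕ.∸ 1))) ℚ./ (ℓ ^ 5)
  where instance _ = m^n≢0 ℓ 2
                 _ = m^n≢0 ℓ 5

{-# OPTIONS --safe #-}
module Submission where

-- Fix a prime ℓ other than 2 and 3 and write A = X·C, B = 2a·C². If ℓ ∣ a then A ≡ −36·432·b⁶
-- (mod ℓ), so (a, b) is good exactly when ℓ ∤ b. If ℓ ∤ a, then X and C have no common root mod ℓ,
-- and (a, b) is good exactly when ℓ⁴ ∤ C(a, b). The roots of C(a, ·) mod ℓ are then simple, so by
-- Hensel lifting each accounts for ℓ² residues b mod ℓ⁶ with ℓ⁴ ∣ C(a, b), and b ↦ a/b matches them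
-- with the r_ℓ roots of C(t, 1). Hence ℓ¹² − count = ℓ⁵·ℓ⁵ + (ℓ⁶ − ℓ⁵)·ℓ²·r_ℓ.

open import Defs
open import Data.Nat using (ℕ; NonZero)
open import Data.Nat.Primality using (Prime)
open import Data.Integer using (+_)
open import Data.Rational using (_/_)
open import Data.Product using (_×_; _,_)
open import Relation.Binary.PropositionalEquality using (_≡_; _≢_; refl)

module Counting where

  open import Data.Nat using (zero; suc; _+_; _*_; _<_; z<s; s<s; >-nonZero⁻¹)
  open import Data.Nat.Divisibility using (_∣_; _∣?_; _∣0; n∣m*n; ∣m+n∣m⇒∣n; ∣m∣n⇒∣m+n; >⇒∤)
  open import Data.Nat.Properties
  open import Algebra.Properties.CommutativeSemigroup +-commutativeSemigroup using (interchange)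
  open import Data.List using (List; []; _∷_; length; filter; map; applyUpTo; upTo; _++_; cartesianProduct)
  open import Data.List.Properties using (length-++; filter-++)
  open import Data.Product using (proj₁; proj₂)
  open import Function using (_∘_; id; _⇔_; Equivalence; mk⇔)
  open import Relation.Nullary using (¬_; Dec; yes; no; contradiction)
  open import Relation.Nullary.Decidable using (¬?; _×-dec_)
  open import Relation.Unary using (Pred; Decidable)
  open import Relation.Binary.PropositionalEquality

  ∑< : ℕ → (ℕ → ℕ) → ℕ
  ∑< zero    f = 0
  ∑< (suc n) f = f 0 + ∑< n (f ∘ suc)

  syntax ∑< n (λ i → e) = ∑[ i < n ] e

  ∑-cong : ∀ n {f g} → (∀ i → i < n → f i ≡ g i) → ∑< n f ≡ ∑< n g
  ∑-cong zero    f≗g = refl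
  ∑-cong (suc n) f≗g = cong₂ _+_ (f≗g 0 z<s) (∑-cong n (λ i i<n → f≗g (suc i) (s<s i<n)))

  ∑-distrib-+ : ∀ n f g → ∑[ i < n ] (f i + g i) ≡ ∑< n f + ∑< n g
  ∑-distrib-+ zero    f g = refl
  ∑-distrib-+ (suc n) f g = trans (cong (_+_ (f 0 + g 0)) (∑-distrib-+ n (f ∘ suc) (g ∘ suc)))
                                  (interchange (f 0) (g 0) _ _)

  ∑-distribˡ-* : ∀ n c f → ∑[ i < n ] (c * f i) ≡ c * ∑< n f
  ∑-distribˡ-* zero    c f = sym (*-zeroʳ c)
  ∑-distribˡ-* (suc n) c f = trans (cong (_+_ (c * f 0)) (∑-distribˡ-* n c (f ∘ suc)))
                                   (sym (*-distribˡ-+ c (f 0) _))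

  ∑-const : ∀ n c → ∑[ i < n ] c ≡ n * c
  ∑-const zero    c = refl
  ∑-const (suc n) c = cong (_+_ c) (∑-const n c)

  ∑-+ : ∀ m n f → ∑< (m + n) f ≡ ∑< m f + ∑[ i < n ] f (m + i)
  ∑-+ zero    n f = refl
  ∑-+ (suc m) n f = trans (cong (_+_ (f 0)) (∑-+ m n (f ∘ suc))) (sym (+-assoc (f 0) _ _))

  ∑-blocks : ∀ k m f → ∑< (k * m) f ≡ ∑[ j < k ] ∑[ y < m ] f (j * m + y)
  ∑-blocks zero    m f = refl
  ∑-blocks (suc k) m f = trans (∑-+ m (k * m) f) (cong (_+_ (∑< m f)) (trans
    (∑-blocks k m (λ i → f (m + i)))
    (∑-cong k (λ j _ → ∑-cong m (λ y _ → cong f (sym (+-assoc m (j * m) y)))))))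

  ∑-periodic : ∀ k m f → (∀ j y → f (j * m + y) ≡ f y) → ∑< (k * m) f ≡ k * ∑< m f
  ∑-periodic k m f periodic = begin
    ∑< (k * m) f                            ≡⟨ ∑-blocks k m f ⟩
    ∑[ j < k ] ∑[ y < m ] f (j * m + y)     ≡⟨ ∑-cong k (λ j _ → ∑-cong m (λ y _ → periodic j y)) ⟩
    ∑[ j < k ] ∑< m f                       ≡⟨ ∑-const k (∑< m f) ⟩
    k * ∑< m f                              ∎
    where open ≡-Reasoning

  ∑-zero : ∀ n {f} → (∀ i → i < n → f i ≡ 0) → ∑< n f ≡ 0
  ∑-zero n f≗0 = trans (∑-cong n f≗0) (trans (∑-const n 0) (*-zeroʳ n))

  ∑-swap : ∀ n m (f : ℕ → ℕ → ℕ) → ∑[ i < n ] ∑[ j < m ] f i j ≡ ∑[ j < m ] ∑[ i < n ] f i j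
  ∑-swap zero    m f = sym (∑-zero m (λ _ _ → refl))
  ∑-swap (suc n) m f = begin
    ∑[ j < m ] f 0 j + ∑[ i < n ] ∑[ j < m ] f (suc i) j  ≡⟨ cong (_+_ (∑[ j < m ] f 0 j)) (∑-swap n m (f ∘ suc)) ⟩
    ∑[ j < m ] f 0 j + ∑[ j < m ] ∑[ i < n ] f (suc i) j  ≡⟨ ∑-distrib-+ m (f 0) (λ j → ∑[ i < n ] f (suc i) j) ⟨
    ∑[ j < m ] (f 0 j + ∑[ i < n ] f (suc i) j)           ∎
    where open ≡-Reasoning

  ∑-single : ∀ n {f} x → x < n → (∀ i → i < n → i ≢ x → f i ≡ 0) → ∑< n f ≡ f x
  ∑-single (suc n) {f} zero    _         others =
    trans (cong (_+_ (f 0)) (∑-zero n (λ i i<n → others (suc i) (s<s i<n) λ ()))) (+-identityʳ (f 0))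
  ∑-single (suc n) {f} (suc x) (s<s x<n) others =
    trans (cong (_+ ∑< n (f ∘ suc)) (others 0 z<s λ ()))
          (∑-single n x x<n (λ i i<n i≢x → others (suc i) (s<s i<n) (i≢x ∘ suc-injective)))

  𝟙 : ∀ {p} {P : Set p} → Dec P → ℕ
  𝟙 (yes _) = 1
  𝟙 (no  _) = 0

  #< : ∀ {p} {P : Pred ℕ p} → ℕ → Decidable P → ℕ
  #< n P? = ∑[ i < n ] 𝟙 (P? i)

  syntax #< n (λ i → d) = #[ i < n ] d

  module _ {p} {P : Set p} where

    𝟙-yes : (P? : Dec P) → P → 𝟙 P? ≡ 1
    𝟙-yes (yes _)  _ = refl
    𝟙-yes (no ¬p) p = contradiction p ¬p

    𝟙-no : (P? : Dec P) → ¬ P → 𝟙 P? ≡ 0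
    𝟙-no (yes p) ¬p = contradiction p ¬p
    𝟙-no (no _)  _  = refl

    𝟙-+-𝟙-¬ : (P? : Dec P) → 𝟙 P? + 𝟙 (¬? P?) ≡ 1
    𝟙-+-𝟙-¬ (yes _) = refl
    𝟙-+-𝟙-¬ (no  _) = refl

  𝟙-¬-cong : ∀ {p q} {P : Set p} {Q : Set q} (P? : Dec P) (Q? : Dec Q) → P ⇔ (¬ Q) → 𝟙 (¬? P?) ≡ 𝟙 Q?
  𝟙-¬-cong (yes p) (yes q)  P⇔¬Q = contradiction q (Equivalence.to P⇔¬Q p)
  𝟙-¬-cong (yes _) (no _)   _     = refl
  𝟙-¬-cong (no _)  (yes _)  _     = refl
  𝟙-¬-cong (no ¬p) (no ¬q)  P⇔¬Q = contradiction (Equivalence.from P⇔¬Q ¬q) ¬p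

  𝟙-cong : ∀ {p q} {P : Set p} {Q : Set q} (P? : Dec P) (Q? : Dec Q) → P ⇔ Q → 𝟙 P? ≡ 𝟙 Q?
  𝟙-cong (yes p) Q? P⇔Q = sym (𝟙-yes Q? (Equivalence.to P⇔Q p))
  𝟙-cong (no ¬p) Q? P⇔Q = sym (𝟙-no Q? (¬p ∘ Equivalence.from P⇔Q))

  module _ {p} {P : Pred ℕ p} (P? : Decidable P) where

    #-zero : ∀ n → (∀ i → i < n → ¬ P i) → #< n P? ≡ 0
    #-zero n none = ∑-zero n (λ i i<n → 𝟙-no (P? i) (none i i<n))

    #-one : ∀ n x → x < n → P x → (∀ i → i < n → P i → i ≡ x) → #< n P? ≡ 1
    #-one n x x<n Px unique =
      trans (∑-single n x x<n (λ i i<n i≢x → 𝟙-no (P? i) (i≢x ∘ unique i i<n))) (𝟙-yes (P? x) Px)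

    #-+-#-¬ : ∀ n → #< n P? + #[ i < n ] ¬? (P? i) ≡ n
    #-+-#-¬ n = begin
      #< n P? + #[ i < n ] ¬? (P? i)        ≡⟨ ∑-distrib-+ n (𝟙 ∘ P?) (𝟙 ∘ ¬? ∘ P?) ⟨
      ∑[ i < n ] (𝟙 (P? i) + 𝟙 (¬? (P? i))) ≡⟨ ∑-cong n (λ i _ → 𝟙-+-𝟙-¬ (P? i)) ⟩
      ∑[ i < n ] 1                          ≡⟨ ∑-const n 1 ⟩
      n * 1                                 ≡⟨ *-identityʳ n ⟩
      n                                     ∎
      where open ≡-Reasoning

    ∑-by-cases : ∀ n f A B → (∀ i → i < n → P i → f i ≡ A) → (∀ i → i < n → ¬ P i → f i ≡ B) →
                 ∑< n f ≡ A * #< n P? + B * #[ i < n ] ¬? (P? i)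
    ∑-by-cases n f A B yes-case no-case = begin
      ∑< n f                                                  ≡⟨ ∑-cong n split ⟩
      ∑[ i < n ] (A * 𝟙 (P? i) + B * 𝟙 (¬? (P? i)))           ≡⟨ ∑-distrib-+ n _ _ ⟩
      ∑[ i < n ] (A * 𝟙 (P? i)) + ∑[ i < n ] (B * 𝟙 (¬? (P? i))) ≡⟨ cong₂ _+_ (∑-distribˡ-* n A _) (∑-distribˡ-* n B _) ⟩
      A * #< n P? + B * #[ i < n ] ¬? (P? i)                   ∎
      where
      open ≡-Reasoning
      split : ∀ i → i < n → f i ≡ A * 𝟙 (P? i) + B * 𝟙 (¬? (P? i))
      split i i<n with P? i
      ... | yes Pi = trans (yes-case i i<n Pi)
                           (sym (trans (cong₂ _+_ (*-identityʳ A) (*-zeroʳ B)) (+-identityʳ A)))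
      ... | no ¬Pi = trans (no-case i i<n ¬Pi) (sym (cong₂ _+_ (*-zeroʳ A) (*-identityʳ B)))

  module _ {p q} {P : Pred ℕ p} {Q : Pred ℕ q} (P? : Decidable P) (Q? : Decidable Q) where

    #-cong : ∀ n → (∀ i → i < n → P i ⇔ Q i) → #< n P? ≡ #< n Q?
    #-cong n P⇔Q = ∑-cong n (λ i i<n → 𝟙-cong (P? i) (Q? i) (P⇔Q i i<n))

    #-¬-cong : ∀ n → (∀ i → i < n → P i ⇔ (¬ Q i)) → #[ i < n ] ¬? (P? i) ≡ #< n Q?
    #-¬-cong n P⇔¬Q = ∑-cong n (λ i i<n → 𝟙-¬-cong (P? i) (Q? i) (P⇔¬Q i i<n))

  module _ {p q} {P : Pred ℕ p} {Q : Pred ℕ q} (P? : Decidable P) (Q? : Decidable Q) where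

    #-double-counting : ∀ {s} {R : ℕ → ℕ → Set s} (R? : ∀ x y → Dec (R x y)) n m →
      (∀ x → x < n → #[ y < m ] R? x y ≡ 𝟙 (P? x)) →
      (∀ y → y < m → #[ x < n ] R? x y ≡ 𝟙 (Q? y)) →
      #< n P? ≡ #< m Q?
    #-double-counting R? n m rows columns = begin
      #< n P?                                  ≡⟨ ∑-cong n rows ⟨
      ∑[ x < n ] ∑[ y < m ] 𝟙 (R? x y)         ≡⟨ ∑-swap n m (λ x y → 𝟙 (R? x y)) ⟩
      ∑[ y < m ] ∑[ x < n ] 𝟙 (R? x y)         ≡⟨ ∑-cong m columns ⟩
      #< m Q?                                  ∎
      where open ≡-Reasoning

    #-matching : ∀ {s} {R : ℕ → ℕ → Set s} (R? : ∀ x y → Dec (R x y)) n m →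
      (∀ x y → R x y → P x ⇔ Q y) →
      (∀ x → x < n → P x → #[ y < m ] R? x y ≡ 1) →
      (∀ y → y < m → Q y → #[ x < n ] R? x y ≡ 1) →
      #< n P? ≡ #< m Q?
    #-matching {R = R} R? n m R⇒P⇔Q rows columns =
      #-double-counting (λ x y → R? x y ×-dec P? x) n m row column
      where
      row : ∀ x → x < n → #[ y < m ] (R? x y ×-dec P? x) ≡ 𝟙 (P? x)
      row x x<n with P? x
      ... | yes Px = trans (#-cong _ (R? x) m (λ y _ → mk⇔ proj₁ (_, Px))) (rows x x<n Px)
      ... | no ¬Px = #-zero _ m (λ y _ → ¬Px ∘ proj₂)
      column : ∀ y → y < m → #[ x < n ] (R? x y ×-dec P? x) ≡ 𝟙 (Q? y)
      column y y<m with Q? y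
      ... | yes Qy = trans (#-cong _ (λ x → R? x y) n (λ x _ → mk⇔ proj₁ from)) (columns y y<m Qy)
        where
        from : ∀ {x} → R x y → R x y × P x
        from Rxy = Rxy , Equivalence.from (R⇒P⇔Q _ y Rxy) Qy
      ... | no ¬Qy = #-zero _ n (λ x _ (Rxy , Px) → ¬Qy (Equivalence.to (R⇒P⇔Q x y Rxy) Px))

  module _ {a p} {A : Set a} {P : Pred A p} (P? : Decidable P) where

    length-filter-applyUpTo : ∀ f n → length (filter P? (applyUpTo f n)) ≡ #[ i < n ] P? (f i)
    length-filter-applyUpTo f zero = refl
    length-filter-applyUpTo f (suc n) with P? (f 0)
    ... | yes _ = cong suc (length-filter-applyUpTo (f ∘ suc) n)
    ... | no  _ = length-filter-applyUpTo (f ∘ suc) n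

    length-filter-map : ∀ {b} {B : Set b} (g : B → A) xs → length (filter P? (map g xs)) ≡ length (filter (P? ∘ g) xs)
    length-filter-map g [] = refl
    length-filter-map g (x ∷ xs) with P? (g x)
    ... | yes _ = cong suc (length-filter-map g xs)
    ... | no  _ = length-filter-map g xs

  length-filter-cartesianProduct : ∀ {p} {P : Pred (ℕ × ℕ) p} (P? : Decidable P) f n m →
    length (filter P? (cartesianProduct (applyUpTo f n) (upTo m))) ≡ ∑[ i < n ] #[ j < m ] P? (f i , j)
  length-filter-cartesianProduct P? f zero    m = refl
  length-filter-cartesianProduct P? f (suc n) m = begin
    length (filter P? (map (f 0 ,_) (upTo m) ++ rest))              ≡⟨ cong length (filter-++ P? (map (f 0 ,_) (upTo m)) rest) ⟩
    length (filter P? (map (f 0 ,_) (upTo m)) ++ filter P? rest)    ≡⟨ length-++ (filter P? (map (f 0 ,_) (upTo m))) ⟩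
    length (filter P? (map (f 0 ,_) (upTo m))) + length (filter P? rest)
      ≡⟨ cong₂ _+_ (trans (length-filter-map P? (f 0 ,_) (upTo m)) (length-filter-applyUpTo (P? ∘ (f 0 ,_)) id m))
                   (length-filter-cartesianProduct P? (f ∘ suc) n m) ⟩
    #[ j < m ] P? (f 0 , j) + ∑[ i < n ] #[ j < m ] P? (f (suc i) , j) ∎
    where
    open ≡-Reasoning
    rest : List (ℕ × ℕ)
    rest = cartesianProduct (applyUpTo (f ∘ suc) n) (upTo m)

  #-multiples : ∀ k m .{{_ : NonZero m}} → #[ b < k * m ] (m ∣? b) ≡ k
  #-multiples k m = begin
    #[ b < k * m ] (m ∣? b)
      ≡⟨ ∑-periodic k m (λ b → 𝟙 (m ∣? b)) (λ j y → 𝟙-cong (m ∣? (j * m + y)) (m ∣? y) (shift j y)) ⟩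
    k * #[ b < m ] (m ∣? b)   ≡⟨ cong (k *_) (#-one (m ∣?_) m 0 (>-nonZero⁻¹ m) (m ∣0) only-0) ⟩
    k * 1                     ≡⟨ *-identityʳ k ⟩
    k                         ∎
    where
    open ≡-Reasoning
    shift : ∀ j y → m ∣ j * m + y ⇔ m ∣ y
    shift j y = mk⇔ (λ m∣jm+y → ∣m+n∣m⇒∣n m∣jm+y (n∣m*n j)) (∣m∣n⇒∣m+n (n∣m*n j))
    only-0 : ∀ i → i < m → m ∣ i → i ≡ 0
    only-0 zero    _   _   = refl
    only-0 (suc i) i<m m∣i = contradiction m∣i (>⇒∤ i<m)

module Divisibility where

  open import Data.Nat as ℕ using (zero; suc)
  import Data.Nat.Properties as ℕ
  import Data.Nat.Divisibility as ℕ
  open import Data.Nat.Primality using (euclidsLemma; prime⇒irreducible; prime⇒nonZero; ¬prime[1])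
  open import Data.Nat.Coprimality using (prime⇒coprime; coprime-Bézout)
  open import Data.Nat.GCD using (module Bézout)
  open import Data.Integer hiding (NonZero; suc; ∣_∣)
  import Data.Integer as ℤ using (∣_∣)
  open import Data.Integer.Properties using (abs-*; pos-+; pos-*; +-identityʳ; *-comm; neg-distribˡ-*; neg-involutive; *-assoc)
  open import Data.Integer.DivMod using (_%ℕ_; _/ℕ_; n%ℕd<d; a≡a%ℕn+[a/ℕn]*n)
  open import Data.Integer.Divisibility.Signed
  open import Data.Integer.Tactic.RingSolver using (solve-∀)
  open import Data.Product as Product using (∃; proj₁; proj₂)
  open import Data.Sum as Sum using (_⊎_; [_,_]′)
  open import Function using (_∘_; id)
  open import Relation.Nullary using (¬_; contradiction)
  open import Relation.Binary.PropositionalEquality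
  open Counting

  ∣-%ℕ : ∀ x m .{{_ : ℕ.NonZero m}} → + m ∣ x - + (x %ℕ m)
  ∣-%ℕ x m = divides (x /ℕ m)
    (trans (cong (_- + (x %ℕ m)) (a≡a%ℕn+[a/ℕn]*n x m)) (r+y-r≡y (+ (x %ℕ m)) ((x /ℕ m) * + m)))
    where
    r+y-r≡y : ∀ r y → r + y - r ≡ y
    r+y-r≡y = solve-∀

  ∣-difference⇒≡ : ∀ {m i j} → i ℕ.< m → j ℕ.< m → + m ∣ + i - + j → i ≡ j
  ∣-difference⇒≡ {m} {i} {j} i<m j<m m∣i-j =
    [ (λ i≤j → ordered i≤j j<m m∣i-j) , (λ j≤i → sym (ordered j≤i i<m m∣j-i)) ]′ (ℕ.≤-total i j)
    where
    -[x-y]≡y-x : ∀ x y → - (x - y) ≡ y - x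
    -[x-y]≡y-x = solve-∀
    m∣j-i : + m ∣ + j - + i
    m∣j-i = subst (+ m ∣_) (-[x-y]≡y-x (+ i) (+ j)) (∣m⇒∣-m m∣i-j)
    x-[x+y]≡-y : ∀ x y → x - (x + y) ≡ - y
    x-[x+y]≡-y = solve-∀
    ordered : ∀ {i j} → i ℕ.≤ j → j ℕ.< m → + m ∣ + i - + j → i ≡ j
    ordered {i} i≤j j<m m∣i-j with ℕ.m≤n⇒∃[o]m+o≡n i≤j
    ... | zero  , refl = sym (ℕ.+-identityʳ i)
    ... | suc k , refl = contradiction (∣⇒∣ᵤ (subst (+ m ∣_) i-[i+k]≡-k m∣i-j))
                                       (ℕ.>⇒∤ (ℕ.≤-<-trans (ℕ.m≤n+m (suc k) i) j<m))
      where
      i-[i+k]≡-k : + i - + (i ℕ.+ suc k) ≡ - + suc k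
      i-[i+k]≡-k = trans (cong (_-_ (+ i)) (pos-+ i (suc k))) (x-[x+y]≡-y (+ i) (+ suc k))

  ∣m-n∣n⇒∣m : ∀ {k m n} → k ∣ m - n → k ∣ n → k ∣ m
  ∣m-n∣n⇒∣m k∣m-n k∣n = ∣m+n∣n⇒∣m k∣m-n (∣m⇒∣-m k∣n)

  ∣m-n∣m⇒∣n : ∀ {k m n} → k ∣ m - n → k ∣ m → k ∣ n
  ∣m-n∣m⇒∣n {k} {n = n} k∣m-n k∣m = subst (k ∣_) (neg-involutive n) (∣m⇒∣-m (∣m+n∣m⇒∣n k∣m-n k∣m))

  prime∣prime⇒≡ : ∀ {p q} → Prime p → Prime q → p ℕ.∣ q → p ≡ q
  prime∣prime⇒≡ p-prime q-prime p∣q =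
    [ (λ p≡1 → contradiction (subst Prime p≡1 p-prime) ¬prime[1]) , id ]′ (prime⇒irreducible q-prime p∣q)

  ∣-*-∣ : ∀ {k l m n} → k ∣ m → l ∣ n → k * l ∣ m * n
  ∣-*-∣ {k} {l} {m} k∣m l∣n = ∣-trans (*-monoˡ-∣ l k∣m) (*-monoʳ-∣ m l∣n)

  module PrimeModulus {p : ℕ} (p-prime : Prime p) where

    instance
      p≢0 : ℕ.NonZero p
      p≢0 = prime⇒nonZero p-prime

    ∣*⇒∣⊎∣ : ∀ x y → + p ∣ x * y → + p ∣ x ⊎ + p ∣ y
    ∣*⇒∣⊎∣ x y p∣xy =
      Sum.map ∣ᵤ⇒∣ ∣ᵤ⇒∣ (euclidsLemma ℤ.∣ x ∣ ℤ.∣ y ∣ p-prime (subst (p ℕ.∣_) (abs-* x y) (∣⇒∣ᵤ p∣xy)))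

    ∤*∤⇒∤ : ∀ {x y} → ¬ + p ∣ x → ¬ + p ∣ y → ¬ + p ∣ x * y
    ∤*∤⇒∤ {x} {y} p∤x p∤y = [ p∤x , p∤y ]′ ∘ ∣*⇒∣⊎∣ x y

    ∤1 : ¬ + p ∣ 1ℤ
    ∤1 p∣1 = ¬prime[1] (subst Prime (ℕ.∣1⇒≡1 (∣⇒∣ᵤ p∣1)) p-prime)

    ∤⇒∤^ : ∀ {x} n → ¬ + p ∣ x → ¬ + p ∣ x ^ n
    ∤⇒∤^ zero    p∤x = ∤1
    ∤⇒∤^ (suc n) p∤x = ∤*∤⇒∤ p∤x (∤⇒∤^ n p∤x)

    ∣^⇒∣ : ∀ x n → + p ∣ x ^ suc n → + p ∣ x
    ∣^⇒∣ x zero    p∣x^1 = [ id , (λ p∣1 → contradiction p∣1 ∤1) ]′ (∣*⇒∣⊎∣ x 1ℤ p∣x^1)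
    ∣^⇒∣ x (suc n) p∣x^n = [ id , ∣^⇒∣ x n ]′ (∣*⇒∣⊎∣ x _ p∣x^n)

    ∣*∤⇒∣ : ∀ {c x} → ¬ + p ∣ c → + p ∣ c * x → + p ∣ x
    ∣*∤⇒∣ {c} {x} p∤c p∣cx = [ (λ p∣c → contradiction p∣c p∤c) , id ]′ (∣*⇒∣⊎∣ c x p∣cx)

    p∣p^[1+k] : ∀ k → + p ∣ + (p ℕ.^ suc k)
    p∣p^[1+k] k = ∣ᵤ⇒∣ (ℕ.m∣m*n (p ℕ.^ k))

    ∤∧∣^*⇒∣^ : ∀ k {x y} → ¬ + p ∣ x → + (p ℕ.^ k) ∣ x * y → + (p ℕ.^ k) ∣ y
    ∤∧∣^*⇒∣^ zero    {y = y} _ _ = ∣ᵤ⇒∣ (ℕ.1∣ ℤ.∣ y ∣)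
    ∤∧∣^*⇒∣^ (suc k) {x} {y} p∤x p^[1+k]∣xy with ∣*∤⇒∣ p∤x (∣-trans (p∣p^[1+k] k) p^[1+k]∣xy)
    ... | divides q refl = subst₂ _∣_ (sym p^[1+k]≡p^k*p) refl (*-monoˡ-∣ (+ p) p^k∣q)
      where
      p^[1+k]≡p^k*p : + (p ℕ.^ suc k) ≡ + (p ℕ.^ k) * + p
      p^[1+k]≡p^k*p = trans (pos-* p (p ℕ.^ k)) (*-comm (+ p) _)
      p^k∣q : + (p ℕ.^ k) ∣ q
      p^k∣q = ∤∧∣^*⇒∣^ k p∤x (*-cancelʳ-∣ (+ p) (subst₂ _∣_ p^[1+k]≡p^k*p (sym (*-assoc x q (+ p))) p^[1+k]∣xy))

    ∤⇒invertible : ∀ {x} → ¬ + p ∣ x → ∃ λ y → + p ∣ x * y - 1ℤ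
    ∤⇒invertible {x} p∤x = Product.map₂ lift (residue-inverse (coprime-Bézout (prime⇒coprime p-prime {{n≢0}} (n%ℕd<d x p))))
      where
      n : ℕ
      n = x %ℕ p
      p∣x-n : + p ∣ x - + n
      p∣x-n = ∣-%ℕ x p
      n≢0 : ℕ.NonZero n
      n≢0 = ℕ.≢-nonZero λ n≡0 → p∤x (subst (+ p ∣_) (+-identityʳ x) (subst (λ k → + p ∣ x - + k) n≡0 p∣x-n))
      lift : ∀ {y} → + p ∣ + n * y - 1ℤ → + p ∣ x * y - 1ℤ
      lift {y} p∣ny-1 = subst (+ p ∣_) (split x (+ n) y) (∣m∣n⇒∣m+n (∣m⇒∣m*n y p∣x-n) p∣ny-1)
        where
        split : ∀ x n y → (x - n) * y + (n * y - 1ℤ) ≡ x * y - 1ℤ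
        split = solve-∀
      residue-inverse : Bézout.Identity 1 p n → ∃ λ y → + p ∣ + n * y - 1ℤ
      residue-inverse (Bézout.+- a b 1+bn≡ap) = - + b , divides (- + a) (begin
        + n * - + b - 1ℤ        ≡⟨ n*-b-1≡-[1+b*n] (+ n) (+ b) ⟩
        - (1ℤ + + b * + n)      ≡⟨ cong (λ k → - (1ℤ + k)) (pos-* b n) ⟨
        - + (1 ℕ.+ b ℕ.* n)     ≡⟨ cong (-_ ∘ +_) 1+bn≡ap ⟩
        - + (a ℕ.* p)           ≡⟨ cong -_ (pos-* a p) ⟩
        - (+ a * + p)           ≡⟨ neg-distribˡ-* (+ a) (+ p) ⟩
        - + a * + p             ∎)
        where
        open ≡-Reasoning
        n*-b-1≡-[1+b*n] : ∀ n b → n * - b - 1ℤ ≡ - (1ℤ + b * n)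
        n*-b-1≡-[1+b*n] = solve-∀
      residue-inverse (Bézout.-+ a b 1+ap≡bn) = + b , divides (+ a) (begin
        + n * + b - 1ℤ          ≡⟨ cong (_- 1ℤ) (trans (pos-* b n) (*-comm (+ b) (+ n))) ⟨
        + (b ℕ.* n) - 1ℤ        ≡⟨ cong (λ k → + k - 1ℤ) 1+ap≡bn ⟨
        1ℤ + + (a ℕ.* p) - 1ℤ   ≡⟨ 1+m-1≡m (+ (a ℕ.* p)) ⟩
        + (a ℕ.* p)             ≡⟨ pos-* a p ⟩
        + a * + p               ∎)
        where
        open ≡-Reasoning
        1+m-1≡m : ∀ m → 1ℤ + m - 1ℤ ≡ m
        1+m-1≡m = solve-∀

    #-linear-congruence : ∀ c u → ¬ + p ∣ u → #[ j < p ] (+ p ∣? + j * u + c) ≡ 1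
    #-linear-congruence c u p∤u = #-one (λ j → + p ∣? + j * u + c) p j₀ (n%ℕd<d x p) p∣j₀u+c unique
      where
      e : ℤ
      e = proj₁ (∤⇒invertible p∤u)
      p∣ue-1 : + p ∣ u * e - 1ℤ
      p∣ue-1 = proj₂ (∤⇒invertible p∤u)
      x : ℤ
      x = - (c * e)
      j₀ : ℕ
      j₀ = x %ℕ p
      solution : ∀ c e u j → j * u + c ≡ - ((- (c * e) - j) * u) - c * (u * e - 1ℤ)
      solution = solve-∀
      p∣j₀u+c : + p ∣ + j₀ * u + c
      p∣j₀u+c = subst (+ p ∣_) (sym (solution c e u (+ j₀)))
                  (∣m∣n⇒∣m-n (∣m⇒∣-m (∣m⇒∣m*n u (∣-%ℕ x p))) (∣n⇒∣m*n c p∣ue-1))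
      difference : ∀ c u j j′ → (j * u + c) - (j′ * u + c) ≡ u * (j - j′)
      difference = solve-∀
      unique : ∀ j → j ℕ.< p → + p ∣ + j * u + c → j ≡ j₀
      unique j j<p p∣ju+c = ∣-difference⇒≡ j<p (n%ℕd<d x p)
        (∣*∤⇒∣ p∤u (subst (+ p ∣_) (difference c u (+ j) (+ j₀)) (∣m∣n⇒∣m-n p∣ju+c p∣j₀u+c)))

module Hensel where

  open import Data.Nat as ℕ using (zero; suc)
  import Data.Nat.Properties as ℕ
  import Data.Nat.Divisibility as ℕ
  open import Data.Integer hiding (NonZero; suc; ∣_∣)
  open import Data.Integer.Properties using (pos-+; pos-*; +-comm)
  open import Data.Integer.Divisibility.Signed
  open import Data.Integer.Tactic.RingSolver using (solve-∀)
  open import Function using (_⇔_; mk⇔; Equivalence)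
  open import Relation.Nullary using (¬_; Dec; yes; no)
  open import Relation.Binary.PropositionalEquality
  open Counting
  open Divisibility

  module Lifting {p : ℕ} (p-prime : Prime p) (F F′ : ℤ → ℤ) (G : ℤ → ℤ → ℤ)
    (taylor : ∀ y h → F (y + h) ≡ F y + h * (F′ y + h * G y h))
    (simple-roots : ∀ y → + p ∣ F y → ¬ + p ∣ F′ y) where

    open PrimeModulus p-prime

    increment-quotient : ℕ → ℕ → ℤ → ℤ
    increment-quotient j m y = + j * (F′ y + + j * + m * G y (+ j * + m))

    F-shift : ∀ j m y → F (+ (j ℕ.* m ℕ.+ y)) ≡ F (+ y) + + m * increment-quotient j m (+ y)
    F-shift j m y = begin
      F (+ (j ℕ.* m ℕ.+ y))
        ≡⟨ cong F (trans (pos-+ (j ℕ.* m) y) (trans (+-comm (+ (j ℕ.* m)) (+ y)) (cong (_+_ (+ y)) (pos-* j m)))) ⟩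
      F (+ y + + j * + m)    ≡⟨ taylor (+ y) (+ j * + m) ⟩
      F (+ y) + + j * + m * (F′ (+ y) + + j * + m * G (+ y) (+ j * + m)) ≡⟨ regroup (F (+ y)) (+ j) (+ m) (F′ (+ y)) _ ⟩
      F (+ y) + + m * increment-quotient j m (+ y) ∎
      where
      open ≡-Reasoning
      regroup : ∀ f j m d g → f + j * m * (d + j * m * g) ≡ f + m * (j * (d + j * m * g))
      regroup = solve-∀

    ∣F-periodic : ∀ {m} j y → (+ m ∣ F (+ (j ℕ.* m ℕ.+ y))) ⇔ (+ m ∣ F (+ y))
    ∣F-periodic {m} j y = mk⇔
      (λ m∣F[jm+y] → ∣m+n∣n⇒∣m (subst (+ m ∣_) (F-shift j m y) m∣F[jm+y]) m∣m*quotient)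
      (λ m∣F[y] → subst (+ m ∣_) (sym (F-shift j m y)) (∣m∣n⇒∣m+n m∣F[y] m∣m*quotient))
      where
      m∣m*quotient : + m ∣ + m * increment-quotient j m (+ y)
      m∣m*quotient = ∣m⇒∣m*n _ ∣-refl

    #-roots-periodic : ∀ k m → #[ b < k ℕ.* m ] (+ m ∣? F (+ b)) ≡ k ℕ.* #[ b < m ] (+ m ∣? F (+ b))
    #-roots-periodic k m = ∑-periodic k m (λ b → 𝟙 (+ m ∣? F (+ b)))
      (λ j y → 𝟙-cong (+ m ∣? F (+ (j ℕ.* m ℕ.+ y))) (+ m ∣? F (+ y)) (∣F-periodic j y))

    -- If F y = c m, then F (j m + y) ≡ (j F′ y + c) m modulo p m, and j F′ y + c ≡ 0 mod p
    -- has exactly one solution j < p because p ∤ F′ y.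
    #-lifts : ∀ m y .{{_ : ℕ.NonZero m}} → p ℕ.∣ m →
              #[ j < p ] (+ (p ℕ.* m) ∣? F (+ (j ℕ.* m ℕ.+ y))) ≡ 𝟙 (+ m ∣? F (+ y))
    #-lifts m y p∣m = lifts (+ m ∣? F (+ y))
      where
      +[p*m]≡+p*+m : + (p ℕ.* m) ≡ + p * + m
      +[p*m]≡+p*+m = pos-* p m
      lifts : (m∣F? : Dec (+ m ∣ F (+ y))) → #[ j < p ] (+ (p ℕ.* m) ∣? F (+ (j ℕ.* m ℕ.+ y))) ≡ 𝟙 m∣F?
      lifts (no m∤F) = #-zero _ p (λ j _ pm∣F → m∤F (Equivalence.to (∣F-periodic j y)
                         (∣-trans (∣ᵤ⇒∣ (ℕ.n∣m*n p)) pm∣F)))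
      lifts (yes (divides c F≡cm)) =
        trans (#-cong _ _ p (λ j _ → root⇔ j)) (#-linear-congruence c (F′ (+ y)) (simple-roots (+ y) p∣F))
        where
        p∣F : + p ∣ F (+ y)
        p∣F = subst (+ p ∣_) (sym F≡cm) (∣n⇒∣m*n c (∣ᵤ⇒∣ p∣m))
        regroup : ∀ c m q → c * m + m * q ≡ (c + q) * m
        regroup = solve-∀
        split : ∀ c j d m g → c + j * (d + j * m * g) ≡ (j * d + c) + m * (j * j * g)
        split = solve-∀
        root⇔ : ∀ j → (+ (p ℕ.* m) ∣ F (+ (j ℕ.* m ℕ.+ y))) ⇔ (+ p ∣ + j * F′ (+ y) + c)
        root⇔ j = mk⇔ to from
          where
          R : ℤ
          R = G (+ y) (+ j * + m)
          F≡[c+quotient]*m : F (+ (j ℕ.* m ℕ.+ y)) ≡ (c + increment-quotient j m (+ y)) * + m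
          F≡[c+quotient]*m = trans (F-shift j m y) (trans (cong (_+ + m * increment-quotient j m (+ y)) F≡cm) (regroup c (+ m) _))
          c+quotient≡ : c + increment-quotient j m (+ y) ≡ (+ j * F′ (+ y) + c) + + m * (+ j * + j * R)
          c+quotient≡ = split c (+ j) (F′ (+ y)) (+ m) R
          p∣m* : + p ∣ + m * (+ j * + j * R)
          p∣m* = ∣m⇒∣m*n (+ j * + j * R) (∣ᵤ⇒∣ {+ p} {+ m} p∣m)
          to : + (p ℕ.* m) ∣ F (+ (j ℕ.* m ℕ.+ y)) → + p ∣ + j * F′ (+ y) + c
          to pm∣F = ∣m+n∣n⇒∣m (subst (+ p ∣_) c+quotient≡
                      (*-cancelʳ-∣ (+ m) (subst₂ _∣_ +[p*m]≡+p*+m F≡[c+quotient]*m pm∣F))) p∣m*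
          from : + p ∣ + j * F′ (+ y) + c → + (p ℕ.* m) ∣ F (+ (j ℕ.* m ℕ.+ y))
          from p∣jF′+c = subst₂ _∣_ (sym +[p*m]≡+p*+m) (sym F≡[c+quotient]*m)
            (*-monoˡ-∣ (+ m) (subst (+ p ∣_) (sym c+quotient≡) (∣m∣n⇒∣m+n p∣jF′+c p∣m*)))

    #-roots-lift : ∀ m .{{_ : ℕ.NonZero m}} → p ℕ.∣ m →
                   #[ b < p ℕ.* m ] (+ (p ℕ.* m) ∣? F (+ b)) ≡ #[ y < m ] (+ m ∣? F (+ y))
    #-roots-lift m p∣m = begin
      #[ b < p ℕ.* m ] (+ (p ℕ.* m) ∣? F (+ b))                      ≡⟨ ∑-blocks p m _ ⟩
      ∑[ j < p ] ∑[ y < m ] 𝟙 (+ (p ℕ.* m) ∣? F (+ (j ℕ.* m ℕ.+ y))) ≡⟨ ∑-swap p m _ ⟩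
      ∑[ y < m ] ∑[ j < p ] 𝟙 (+ (p ℕ.* m) ∣? F (+ (j ℕ.* m ℕ.+ y))) ≡⟨ ∑-cong m (λ y _ → #-lifts m y p∣m) ⟩
      #[ y < m ] (+ m ∣? F (+ y))                                    ∎
      where open ≡-Reasoning

    #-roots-mod-p^ : ∀ k → #[ b < p ℕ.^ suc k ] (+ (p ℕ.^ suc k) ∣? F (+ b)) ≡ #[ y < p ] (+ p ∣? F (+ y))
    #-roots-mod-p^ zero    = cong (λ n → #[ b < n ] (+ n ∣? F (+ b))) (ℕ.*-identityʳ p)
    #-roots-mod-p^ (suc k) = trans (#-roots-lift (p ℕ.^ suc k) {{ℕ.m^n≢0 p (suc k)}} (ℕ.m∣m*n (p ℕ.^ k))) (#-roots-mod-p^ k)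

module Forms where

  open import Data.Nat as ℕ using ()
  open import Data.Integer hiding (NonZero)
  open import Data.Integer.Properties using (pos-+; pos-*)
  open import Data.Integer.Divisibility.Signed using (_∣_; ∣m⇒∣m*n)
  open import Data.Integer.Solver using (module +-*-Solver)
  open +-*-Solver
  open import Relation.Binary.PropositionalEquality

  X : ℤ → ℤ → ℤ
  X a b = - (+ 3) * a ^ 2 - + 36 * b ^ 2

  ∂C : ℤ → ℤ → ℤ
  ∂C a b = + 72 * a ^ 2 * b + + 1728 * b ^ 3

  private
    C⟨_,_⟩ : ∀ {n} → Polynomial n → Polynomial n → Polynomial n
    C⟨ a , b ⟩ = a :^ 4 :+ con (+ 36) :* a :^ 2 :* b :^ 2 :+ con (+ 432) :* b :^ 4

    X⟨_,_⟩ : ∀ {n} → Polynomial n → Polynomial n → Polynomial n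
    X⟨ a , b ⟩ = :- con (+ 3) :* a :^ 2 :- con (+ 36) :* b :^ 2

  Bp≡2a*Cp² : ∀ a b → Bp a b ≡ + 2 * a * (Cp a b * Cp a b)
  Bp≡2a*Cp² = solve 2 (λ a b →
    (con (+ 2) :* a :^ 5 :+ con (+ 72) :* a :^ 3 :* b :^ 2 :+ con (+ 864) :* a :* b :^ 4) :* C⟨ a , b ⟩
    := con (+ 2) :* a :* (C⟨ a , b ⟩ :* C⟨ a , b ⟩)) refl

  Cp-differenceˡ : ∀ a a′ b → Cp a b - Cp a′ b ≡ (a - a′) * ((a + a′) * (a ^ 2 + a′ ^ 2 + + 36 * b ^ 2))
  Cp-differenceˡ = solve 3 (λ a a′ b →
    C⟨ a , b ⟩ :- C⟨ a′ , b ⟩ := (a :- a′) :* ((a :+ a′) :* (a :^ 2 :+ a′ :^ 2 :+ con (+ 36) :* b :^ 2))) refl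

  Cp-remainder : ℤ → ℤ → ℤ → ℤ
  Cp-remainder a y h = + 36 * a ^ 2 + + 432 * (+ 6 * y ^ 2 + + 4 * y * h + h ^ 2)

  Cp-taylor : ∀ a y h → Cp a (y + h) ≡ Cp a y + h * (∂C a y + h * Cp-remainder a y h)
  Cp-taylor = solve 3 (λ a y h →
    C⟨ a , y :+ h ⟩
    := C⟨ a , y ⟩ :+ h :* (con (+ 72) :* a :^ 2 :* y :+ con (+ 1728) :* y :^ 3
                           :+ h :* (con (+ 36) :* a :^ 2 :+ con (+ 432) :* (con (+ 6) :* y :^ 2 :+ con (+ 4) :* y :* h :+ h :^ 2)))) refl

  Cp-homogeneous : ∀ t b → Cp (t * b) b ≡ b ^ 4 * Cp t 1ℤ
  Cp-homogeneous = solve 2 (λ t b → C⟨ t :* b , b ⟩ := b :^ 4 :* C⟨ t , con 1ℤ ⟩) refl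

  Cp-mod-a : ∀ a b → Cp a b ≡ a * (a ^ 3 + + 36 * a * b ^ 2) + + 432 * b ^ 4
  Cp-mod-a = solve 2 (λ a b → C⟨ a , b ⟩ := a :* (a :^ 3 :+ con (+ 36) :* a :* b :^ 2) :+ con (+ 432) :* b :^ 4) refl

  Cp-mod-b : ∀ a b → Cp a b ≡ b * (+ 36 * a ^ 2 * b + + 432 * b ^ 3) + a ^ 4
  Cp-mod-b = solve 2 (λ a b → C⟨ a , b ⟩ := b :* (con (+ 36) :* a :^ 2 :* b :+ con (+ 432) :* b :^ 3) :+ a :^ 4) refl

  Cp-mod-t : ∀ t → Cp t 1ℤ ≡ t * (t ^ 3 + + 36 * t) + + 432
  Cp-mod-t = solve 1 (λ t → C⟨ t , con 1ℤ ⟩ := t :* (t :^ 3 :+ con (+ 36) :* t) :+ con (+ 432)) refl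

  X-mod-a : ∀ a b → X a b ≡ a * (- (+ 3) * a) - + 36 * b ^ 2
  X-mod-a = solve 2 (λ a b → X⟨ a , b ⟩ := a :* (:- con (+ 3) :* a) :- con (+ 36) :* b :^ 2) refl

  -X-36b² : ∀ a b → - X a b - + 36 * b ^ 2 ≡ + 3 * a ^ 2
  -X-36b² = solve 2 (λ a b → :- X⟨ a , b ⟩ :- con (+ 36) :* b :^ 2 := con (+ 3) :* a :^ 2) refl

  3Cp+X*[a²+24b²] : ∀ a b → + 3 * Cp a b + X a b * (a ^ 2 + + 24 * b ^ 2) ≡ + 432 * b ^ 4
  3Cp+X*[a²+24b²] = solve 2 (λ a b →
    con (+ 3) :* C⟨ a , b ⟩ :+ X⟨ a , b ⟩ :* (a :^ 2 :+ con (+ 24) :* b :^ 2) := con (+ 432) :* b :^ 4) refl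

  ∂C-factor : ∀ a b → ∂C a b ≡ + 72 * b * (a ^ 2 + + 24 * b ^ 2)
  ∂C-factor = solve 2 (λ a b →
    con (+ 72) :* a :^ 2 :* b :+ con (+ 1728) :* b :^ 3 := con (+ 72) :* b :* (a :^ 2 :+ con (+ 24) :* b :^ 2)) refl

  Cp-mod-a²+24b² : ∀ a b → Cp a b ≡ (a ^ 2 + + 24 * b ^ 2) * (a ^ 2 + + 12 * b ^ 2) + + 144 * b ^ 4
  Cp-mod-a²+24b² = solve 2 (λ a b →
    C⟨ a , b ⟩ := (a :^ 2 :+ con (+ 24) :* b :^ 2) :* (a :^ 2 :+ con (+ 12) :* b :^ 2) :+ con (+ 144) :* b :^ 4) refl

  pos-^ : ∀ m n → + (m ℕ.^ n) ≡ (+ m) ^ n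
  pos-^ m ℕ.zero    = refl
  pos-^ m (ℕ.suc n) = trans (pos-* m (m ℕ.^ n)) (cong (+ m *_) (pos-^ m n))

  pos-Cp : ∀ t → + (t ℕ.^ 4 ℕ.+ 36 ℕ.* t ℕ.^ 2 ℕ.+ 432) ≡ Cp (+ t) 1ℤ
  pos-Cp t = begin
    + (t ℕ.^ 4 ℕ.+ 36 ℕ.* t ℕ.^ 2 ℕ.+ 432)  ≡⟨ pos-+ (t ℕ.^ 4 ℕ.+ 36 ℕ.* t ℕ.^ 2) 432 ⟩
    + (t ℕ.^ 4 ℕ.+ 36 ℕ.* t ℕ.^ 2) + + 432  ≡⟨ cong (_+ + 432) (pos-+ (t ℕ.^ 4) (36 ℕ.* t ℕ.^ 2)) ⟩
    + (t ℕ.^ 4) + + (36 ℕ.* t ℕ.^ 2) + + 432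
      ≡⟨ cong₂ (λ u v → u + v + + 432) (pos-^ t 4) (trans (pos-* 36 (t ℕ.^ 2)) (cong (+ 36 *_) (pos-^ t 2))) ⟩
    (+ t) ^ 4 + + 36 * (+ t) ^ 2 + + 432
      ≡⟨ solve 1 (λ t → t :^ 4 :+ con (+ 36) :* t :^ 2 :+ con (+ 432) := C⟨ t , con 1ℤ ⟩) refl (+ t) ⟩
    Cp (+ t) 1ℤ                              ∎
    where open ≡-Reasoning

  Cp-congˡ : ∀ {m a a′} b → + m ∣ a - a′ → + m ∣ Cp a b - Cp a′ b
  Cp-congˡ {m} {a} {a′} b m∣a-a′ = subst (+ m ∣_) (sym (Cp-differenceˡ a a′ b))
    (∣m⇒∣m*n ((a + a′) * (a ^ 2 + a′ ^ 2 + + 36 * b ^ 2)) m∣a-a′)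

module FormsModPrime {ℓ : ℕ} (ℓ-prime : Prime ℓ) (ℓ≢2 : ℓ ≢ 2) (ℓ≢3 : ℓ ≢ 3) where

  open import Data.Nat as ℕ using (suc)
  import Data.Nat.Properties as ℕ
  import Data.Nat.Divisibility as ℕ
  open import Data.Nat.Primality using (prime?; prime[2])
  open import Data.Integer hiding (NonZero; suc; ∣_∣)
  import Data.Integer as ℤ using (∣_∣)
  open import Data.Integer.Properties using (pos-*; *-comm)
  open import Data.Integer.Divisibility.Signed
  open import Data.Sum using (inj₁; inj₂; [_,_]′)
  open import Data.Product using (proj₁; proj₂)
  open import Function using (_∘_; id; _⇔_; mk⇔)
  open import Relation.Nullary using (¬_; yes; no)
  open import Relation.Nullary.Decidable using (from-yes)
  open import Relation.Binary.PropositionalEquality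
  open Counting
  open Divisibility
  open Forms
  open PrimeModulus ℓ-prime

  ∤2^i*3^j : ∀ i j → ¬ + ℓ ∣ (+ 2) ^ i * (+ 3) ^ j
  ∤2^i*3^j i j = ∤*∤⇒∤ (∤⇒∤^ i ∤2) (∤⇒∤^ j ∤3)
    where
    ∤2 : ¬ + ℓ ∣ + 2
    ∤2 = ℓ≢2 ∘ prime∣prime⇒≡ ℓ-prime prime[2] ∘ ∣⇒∣ᵤ
    ∤3 : ¬ + ℓ ∣ + 3
    ∤3 = ℓ≢3 ∘ prime∣prime⇒≡ ℓ-prime (from-yes (prime? 3)) ∘ ∣⇒∣ᵤ

  ∣a∧∤b⇒∤Ap : ∀ {a b} → + ℓ ∣ a → ¬ + ℓ ∣ b → ¬ + ℓ ∣ Ap a b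
  ∣a∧∤b⇒∤Ap {a} {b} ℓ∣a ℓ∤b = ∤*∤⇒∤ ℓ∤X ℓ∤Cp
    where
    ℓ∤X : ¬ + ℓ ∣ X a b
    ℓ∤X ℓ∣X = ∤*∤⇒∤ (∤2^i*3^j 2 2) (∤⇒∤^ 2 ℓ∤b)
      (∣m-n∣m⇒∣n (subst (+ ℓ ∣_) (X-mod-a a b) ℓ∣X) (∣m⇒∣m*n (- (+ 3) * a) ℓ∣a))
    ℓ∤Cp : ¬ + ℓ ∣ Cp a b
    ℓ∤Cp ℓ∣Cp = ∤*∤⇒∤ (∤2^i*3^j 4 3) (∤⇒∤^ 4 ℓ∤b)
      (∣m+n∣m⇒∣n (subst (+ ℓ ∣_) (Cp-mod-a a b) ℓ∣Cp) (∣m⇒∣m*n (a ^ 3 + + 36 * a * b ^ 2) ℓ∣a))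

  ∣c*x^[1+n]⇒∣x : ∀ i j n {x} → + ℓ ∣ (+ 2) ^ i * (+ 3) ^ j * x ^ suc n → + ℓ ∣ x
  ∣c*x^[1+n]⇒∣x i j n {x} = ∣^⇒∣ x n ∘ ∣*∤⇒∣ (∤2^i*3^j i j)

  ∤a∧∣Cp⇒∤X : ∀ {a b} → ¬ + ℓ ∣ a → + ℓ ∣ Cp a b → ¬ + ℓ ∣ X a b
  ∤a∧∣Cp⇒∤X {a} {b} ℓ∤a ℓ∣Cp ℓ∣X = ℓ∤a ℓ∣a
    where
    ℓ∣b : + ℓ ∣ b
    ℓ∣b = ∣c*x^[1+n]⇒∣x 4 3 3 (subst (+ ℓ ∣_) (3Cp+X*[a²+24b²] a b)
            (∣m∣n⇒∣m+n (∣n⇒∣m*n (+ 3) ℓ∣Cp) (∣m⇒∣m*n (a ^ 2 + + 24 * b ^ 2) ℓ∣X)))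
    ℓ∣a : + ℓ ∣ a
    ℓ∣a = ∣c*x^[1+n]⇒∣x 0 1 1 (subst (+ ℓ ∣_) (-X-36b² a b)
            (∣m∣n⇒∣m-n (∣m⇒∣-m ℓ∣X) (∣n⇒∣m*n (+ 36) (∣m⇒∣m*n (b ^ 1) ℓ∣b))))

  ∤a∧∣Cp⇒∤b : ∀ {a b} → ¬ + ℓ ∣ a → + ℓ ∣ Cp a b → ¬ + ℓ ∣ b
  ∤a∧∣Cp⇒∤b {a} {b} ℓ∤a ℓ∣Cp ℓ∣b =
    ℓ∤a (∣^⇒∣ a 3 (∣m+n∣m⇒∣n (subst (+ ℓ ∣_) (Cp-mod-b a b) ℓ∣Cp) (∣m⇒∣m*n (+ 36 * a ^ 2 * b + + 432 * b ^ 3) ℓ∣b)))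

  ∤a∧∣Cp⇒∤∂C : ∀ {a b} → ¬ + ℓ ∣ a → + ℓ ∣ Cp a b → ¬ + ℓ ∣ ∂C a b
  ∤a∧∣Cp⇒∤∂C {a} {b} ℓ∤a ℓ∣Cp ℓ∣∂C = [ ℓ∤72b , ℓ∤b ∘ ℓ∣b ]′
    (∣*⇒∣⊎∣ (+ 72 * b) (a ^ 2 + + 24 * b ^ 2) (subst (+ ℓ ∣_) (∂C-factor a b) ℓ∣∂C))
    where
    ℓ∤b : ¬ + ℓ ∣ b
    ℓ∤b = ∤a∧∣Cp⇒∤b ℓ∤a ℓ∣Cp
    ℓ∤72b : ¬ + ℓ ∣ + 72 * b
    ℓ∤72b = ∤*∤⇒∤ (∤2^i*3^j 3 2) ℓ∤b
    ℓ∣b : + ℓ ∣ a ^ 2 + + 24 * b ^ 2 → + ℓ ∣ b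
    ℓ∣b ℓ∣a²+24b² = ∣c*x^[1+n]⇒∣x 4 2 3
      (∣m+n∣m⇒∣n (subst (+ ℓ ∣_) (Cp-mod-a²+24b² a b) ℓ∣Cp) (∣m⇒∣m*n (a ^ 2 + + 12 * b ^ 2) ℓ∣a²+24b²))

  ∣Cp[t,1]⇒∤t : ∀ {t} → + ℓ ∣ Cp t 1ℤ → ¬ + ℓ ∣ t
  ∣Cp[t,1]⇒∤t {t} ℓ∣Cp ℓ∣t =
    ∤2^i*3^j 4 3 (∣m+n∣m⇒∣n (subst (+ ℓ ∣_) (Cp-mod-t t) ℓ∣Cp) (∣m⇒∣m*n (t ^ 3 + + 36 * t) ℓ∣t))

  Good⇔∤b : ∀ {a b} → ℓ ℕ.∣ a → Good ℓ (a , b) ⇔ (¬ ℓ ℕ.∣ b)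
  Good⇔∤b {a} {b} ℓ∣a = mk⇔ (λ (ℓ∤a×b , _) ℓ∣b → ℓ∤a×b (ℓ∣a , ℓ∣b))
                            (λ ℓ∤b → ℓ∤b ∘ proj₂ , inj₁ (ℓ∤Ap ℓ∤b ∘ ∣-trans (p∣p^[1+k] 3) ∘ ∣ᵤ⇒∣ {+ (ℓ ℕ.^ 4)} {A}))
    where
    A : ℤ
    A = Ap (+ a) (+ b)
    ℓ∤Ap : ¬ ℓ ℕ.∣ b → ¬ + ℓ ∣ A
    ℓ∤Ap ℓ∤b = ∣a∧∤b⇒∤Ap {+ a} {+ b} (∣ᵤ⇒∣ ℓ∣a) (ℓ∤b ∘ ∣⇒∣ᵤ)

  Good⇔∤Cp : ∀ {a b} → ¬ ℓ ℕ.∣ a → Good ℓ (a , b) ⇔ (¬ + (ℓ ℕ.^ 4) ∣ Cp (+ a) (+ b))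
  Good⇔∤Cp {a} {b} ℓ∤a = mk⇔ to from
    where
    A B C : ℤ
    A = Ap (+ a) (+ b)
    B = Bp (+ a) (+ b)
    C = Cp (+ a) (+ b)
    ℓ∤a′ : ¬ + ℓ ∣ + a
    ℓ∤a′ = ℓ∤a ∘ ∣⇒∣ᵤ
    ℓ^2∣ℓ^4 : + (ℓ ℕ.^ 2) ∣ + (ℓ ℕ.^ 4)
    ℓ^2∣ℓ^4 = ∣ᵤ⇒∣ (subst (ℓ ℕ.^ 2 ℕ.∣_) (sym (ℕ.^-distribˡ-+-* ℓ 2 2)) (ℕ.m∣m*n (ℓ ℕ.^ 2)))
    ℓ^6∣C*C : + (ℓ ℕ.^ 4) ∣ C → + (ℓ ℕ.^ 6) ∣ C * C
    ℓ^6∣C*C ℓ^4∣C = subst (_∣ C * C) (sym (trans (cong +_ (ℕ.^-distribˡ-+-* ℓ 4 2)) (pos-* (ℓ ℕ.^ 4) (ℓ ℕ.^ 2))))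
                      (∣-*-∣ ℓ^4∣C (∣-trans ℓ^2∣ℓ^4 ℓ^4∣C))
    to : Good ℓ (a , b) → ¬ + (ℓ ℕ.^ 4) ∣ C
    to (_ , inj₁ ℓ^4∤A) ℓ^4∣C = ℓ^4∤A (∣⇒∣ᵤ (∣n⇒∣m*n (X (+ a) (+ b)) ℓ^4∣C))
    to (_ , inj₂ ℓ^6∤B) ℓ^4∣C =
      ℓ^6∤B (∣⇒∣ᵤ (subst (_ ∣_) (sym (Bp≡2a*Cp² (+ a) (+ b))) (∣n⇒∣m*n (+ 2 * + a) (ℓ^6∣C*C ℓ^4∣C))))
    ℓ∣B⇒ℓ∣C : + ℓ ∣ B → + ℓ ∣ C
    ℓ∣B⇒ℓ∣C ℓ∣B = [ id , id ]′
      (∣*⇒∣⊎∣ C C (∣*∤⇒∣ (∤*∤⇒∤ (∤2^i*3^j 1 0) ℓ∤a′) (subst (+ ℓ ∣_) (Bp≡2a*Cp² (+ a) (+ b)) ℓ∣B)))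
    from : ¬ + (ℓ ℕ.^ 4) ∣ C → Good ℓ (a , b)
    from ℓ^4∤C with (ℓ ℕ.^ 4) ℕ.∣? ℤ.∣ A ∣
    ... | no ℓ^4∤A = ℓ∤a ∘ proj₁ , inj₁ ℓ^4∤A
    ... | yes ℓ^4∣A = ℓ∤a ∘ proj₁ , inj₂ λ ℓ^6∣B →
      let ℓ∣C = ℓ∣B⇒ℓ∣C (∣-trans (p∣p^[1+k] 5) (∣ᵤ⇒∣ {+ (ℓ ℕ.^ 6)} {B} ℓ^6∣B)) in
      ℓ^4∤C (∤∧∣^*⇒∣^ 4 (∤a∧∣Cp⇒∤X {+ a} {+ b} ℓ∤a′ ℓ∣C) (∣ᵤ⇒∣ {+ (ℓ ℕ.^ 4)} {A} ℓ^4∣A))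

  -- Roots b and t correspond when t b ≡ a (mod ℓ), since then Cp a b ≡ b ^ 4 * Cp t 1.
  #-roots-dehomogenise : ∀ {a} → ¬ + ℓ ∣ a →
    #[ b < ℓ ] (+ ℓ ∣? Cp a (+ b)) ≡ #[ t < ℓ ] (+ ℓ ∣? Cp (+ t) 1ℤ)
  #-roots-dehomogenise {a} ℓ∤a =
    #-matching (λ b → + ℓ ∣? Cp a (+ b)) (λ t → + ℓ ∣? Cp (+ t) 1ℤ) (λ b t → + ℓ ∣? + t * + b - a) ℓ ℓ
      roots-correspond unique-t unique-b
    where
    ℓ∤b : ∀ {b t} → + ℓ ∣ + t * + b - a → ¬ + ℓ ∣ + b
    ℓ∤b {b} {t} ℓ∣tb-a ℓ∣b = ℓ∤a (∣m-n∣m⇒∣n ℓ∣tb-a (∣n⇒∣m*n (+ t) ℓ∣b))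
    roots-correspond : ∀ b t → + ℓ ∣ + t * + b - a → (+ ℓ ∣ Cp a (+ b)) ⇔ (+ ℓ ∣ Cp (+ t) 1ℤ)
    roots-correspond b t ℓ∣tb-a = mk⇔
      (λ ℓ∣Cp[a,b] → ∣*∤⇒∣ (∤⇒∤^ 4 (ℓ∤b {b} {t} ℓ∣tb-a)) (∣m-n∣n⇒∣m ℓ∣b⁴Cp[t,1]-Cp[a,b] ℓ∣Cp[a,b]))
      (λ ℓ∣Cp[t,1] → ∣m-n∣m⇒∣n ℓ∣b⁴Cp[t,1]-Cp[a,b] (∣n⇒∣m*n ((+ b) ^ 4) ℓ∣Cp[t,1]))
      where
      ℓ∣b⁴Cp[t,1]-Cp[a,b] : + ℓ ∣ (+ b) ^ 4 * Cp (+ t) 1ℤ - Cp a (+ b)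
      ℓ∣b⁴Cp[t,1]-Cp[a,b] = subst (λ z → + ℓ ∣ z - Cp a (+ b)) (Cp-homogeneous (+ t) (+ b))
                              (Cp-congˡ {ℓ} {+ t * + b} {a} (+ b) ℓ∣tb-a)
    unique-t : ∀ b → b ℕ.< ℓ → + ℓ ∣ Cp a (+ b) → #[ t < ℓ ] (+ ℓ ∣? + t * + b - a) ≡ 1
    unique-t b _ ℓ∣Cp = #-linear-congruence (- a) (+ b) (∤a∧∣Cp⇒∤b ℓ∤a ℓ∣Cp)
    unique-b : ∀ t → t ℕ.< ℓ → + ℓ ∣ Cp (+ t) 1ℤ → #[ b < ℓ ] (+ ℓ ∣? + t * + b - a) ≡ 1
    unique-b t _ ℓ∣Cp = trans
      (#-cong _ (λ b → + ℓ ∣? + b * + t - a) ℓ (λ b _ → mk⇔ (subst (λ z → + ℓ ∣ z - a) (*-comm (+ t) (+ b)))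
                                                              (subst (λ z → + ℓ ∣ z - a) (*-comm (+ b) (+ t)))))
      (#-linear-congruence (- a) (+ t) (∣Cp[t,1]⇒∤t ℓ∣Cp))

module Rationals where

  open import Data.Nat as ℕ using (suc)
  import Data.Integer as ℤ
  open import Data.Integer.Properties using (pos-+; pos-*)
  open import Data.Integer.Tactic.RingSolver using (solve-∀)
  open import Data.Rational using (1ℚ; _-_; -_; toℚᵘ)
  open import Data.Rational.Properties using (toℚᵘ-injective; toℚᵘ-fromℚᵘ; toℚᵘ-homo-+; toℚᵘ-homo‿-)
  open import Data.Rational.Unnormalised as ℚᵘ using (mkℚᵘ; *≡*; _≃_)
  import Data.Rational.Unnormalised.Properties as ℚᵘ
  open import Relation.Binary.PropositionalEquality

  toℚᵘ-/ : ∀ i n .{{_ : ℕ.NonZero n}} → toℚᵘ (i / n) ≃ mkℚᵘ i (ℕ.pred n)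
  toℚᵘ-/ i (suc n) = toℚᵘ-fromℚᵘ (mkℚᵘ i n)

  toℚᵘ-homo-minus : ∀ x y → toℚᵘ (x - y) ≃ toℚᵘ x ℚᵘ.- toℚᵘ y
  toℚᵘ-homo-minus x y = ℚᵘ.≃-trans (toℚᵘ-homo-+ x (- y)) (ℚᵘ.+-congʳ (toℚᵘ x) (toℚᵘ-homo‿- y))

  -- The cross-multiplied equation is stated with ↥ and ↧ exactly as ℚᵘ._+_ computes them
  -- (hence the factors + 1), so that it is accepted by *≡* up to conversion.
  c/d≃ᵘ1-1/p-R/q : ∀ c R d p q .{{_ : ℕ.NonZero d}} .{{_ : ℕ.NonZero p}} .{{_ : ℕ.NonZero q}} →
    c ℕ.* (p ℕ.* q) ℕ.+ d ℕ.* q ℕ.+ d ℕ.* p ℕ.* R ≡ d ℕ.* (p ℕ.* q) →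
    mkℚᵘ (+ c) (ℕ.pred d) ≃ ℚᵘ.1ℚᵘ ℚᵘ.- mkℚᵘ (+ 1) (ℕ.pred p) ℚᵘ.- mkℚᵘ (+ R) (ℕ.pred q)
  c/d≃ᵘ1-1/p-R/q c R d@(suc _) p@(suc _) q@(suc _) eq = *≡* (begin
    + c ℤ.* ((+ 1 ℤ.* + p) ℤ.* + q)                                    ≡⟨ isolate (+ c) (+ d) (+ p) (+ q) (+ R) ⟩
    (+ c ℤ.* (+ p ℤ.* + q) ℤ.+ + d ℤ.* + q ℤ.+ + d ℤ.* + p ℤ.* + R)
      ℤ.- + d ℤ.* + q ℤ.- + d ℤ.* + p ℤ.* + R
      ≡⟨ cong (λ z → z ℤ.- + d ℤ.* + q ℤ.- + d ℤ.* + p ℤ.* + R) eqℤ ⟩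
    + d ℤ.* (+ p ℤ.* + q) ℤ.- + d ℤ.* + q ℤ.- + d ℤ.* + p ℤ.* + R     ≡⟨ expand (+ d) (+ p) (+ q) (+ R) ⟩
    ((+ 1 ℤ.* + p ℤ.+ ℤ.- + 1 ℤ.* + 1) ℤ.* + q ℤ.+ ℤ.- + R ℤ.* (+ 1 ℤ.* + p)) ℤ.* + d ∎)
    where
    open ≡-Reasoning
    isolate : ∀ c d p q r → c ℤ.* ((+ 1 ℤ.* p) ℤ.* q) ≡
                            (c ℤ.* (p ℤ.* q) ℤ.+ d ℤ.* q ℤ.+ d ℤ.* p ℤ.* r) ℤ.- d ℤ.* q ℤ.- d ℤ.* p ℤ.* r
    isolate = solve-∀
    expand : ∀ d p q r → d ℤ.* (p ℤ.* q) ℤ.- d ℤ.* q ℤ.- d ℤ.* p ℤ.* r ≡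
                         ((+ 1 ℤ.* p ℤ.+ ℤ.- + 1 ℤ.* + 1) ℤ.* q ℤ.+ ℤ.- r ℤ.* (+ 1 ℤ.* p)) ℤ.* d
    expand = solve-∀
    eqℤ : + c ℤ.* (+ p ℤ.* + q) ℤ.+ + d ℤ.* + q ℤ.+ + d ℤ.* + p ℤ.* + R ≡ + d ℤ.* (+ p ℤ.* + q)
    eqℤ = begin
      + c ℤ.* (+ p ℤ.* + q) ℤ.+ + d ℤ.* + q ℤ.+ + d ℤ.* + p ℤ.* + R
        ≡⟨ cong₂ (λ x y → x ℤ.+ + (d ℕ.* q) ℤ.+ y) (pos-* c (p ℕ.* q)) (pos-* (d ℕ.* p) R) ⟨
      + (c ℕ.* (p ℕ.* q)) ℤ.+ + (d ℕ.* q) ℤ.+ + (d ℕ.* p ℕ.* R)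
        ≡⟨ trans (pos-+ (c ℕ.* (p ℕ.* q) ℕ.+ d ℕ.* q) (d ℕ.* p ℕ.* R))
                 (cong (ℤ._+ + (d ℕ.* p ℕ.* R)) (pos-+ (c ℕ.* (p ℕ.* q)) (d ℕ.* q))) ⟨
      + (c ℕ.* (p ℕ.* q) ℕ.+ d ℕ.* q ℕ.+ d ℕ.* p ℕ.* R)   ≡⟨ cong +_ eq ⟩
      + (d ℕ.* (p ℕ.* q))                                ∎

  c/d≡1-1/p-R/q : ∀ c R d p q .{{_ : ℕ.NonZero d}} .{{_ : ℕ.NonZero p}} .{{_ : ℕ.NonZero q}} →
    c ℕ.* (p ℕ.* q) ℕ.+ d ℕ.* q ℕ.+ d ℕ.* p ℕ.* R ≡ d ℕ.* (p ℕ.* q) →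
    (+ c) / d ≡ 1ℚ - (+ 1) / p - (+ R) / q
  c/d≡1-1/p-R/q c R d p q eq = toℚᵘ-injective (begin
    toℚᵘ ((+ c) / d)                                              ≈⟨ toℚᵘ-/ (+ c) d ⟩
    mkℚᵘ (+ c) (ℕ.pred d)                                         ≈⟨ c/d≃ᵘ1-1/p-R/q c R d p q eq ⟩
    ℚᵘ.1ℚᵘ ℚᵘ.- mkℚᵘ (+ 1) (ℕ.pred p) ℚᵘ.- mkℚᵘ (+ R) (ℕ.pred q)
      ≈⟨ ℚᵘ.+-cong (ℚᵘ.+-congʳ ℚᵘ.1ℚᵘ (ℚᵘ.-‿cong (toℚᵘ-/ (+ 1) p))) (ℚᵘ.-‿cong (toℚᵘ-/ (+ R) q)) ⟨
    toℚᵘ 1ℚ ℚᵘ.- toℚᵘ ((+ 1) / p) ℚᵘ.- toℚᵘ ((+ R) / q)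
      ≈⟨ ℚᵘ.+-cong (toℚᵘ-homo-minus 1ℚ ((+ 1) / p)) ℚᵘ.≃-refl ⟨
    toℚᵘ (1ℚ - (+ 1) / p) ℚᵘ.- toℚᵘ ((+ R) / q)                 ≈⟨ toℚᵘ-homo-minus (1ℚ - (+ 1) / p) ((+ R) / q) ⟨
    toℚᵘ (1ℚ - (+ 1) / p - (+ R) / q)                           ∎)
    where open ℚᵘ.≃-Reasoning

module DensityFormula {ℓ : ℕ} (ℓ-prime : Prime ℓ) (ℓ≢2 : ℓ ≢ 2) (ℓ≢3 : ℓ ≢ 3) where

  open import Data.Nat as ℕ using (_+_; _*_; _^_; _∸_)
  import Data.Nat.Properties as ℕ
  open import Data.Nat.Divisibility using (_∣_; _∣?_)
  open import Data.Nat.Solver using (module +-*-Solver)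
  open import Data.Integer as ℤ using (1ℤ)
  open import Data.Integer.Divisibility.Signed as ℤ using (∣ᵤ⇒∣; ∣⇒∣ᵤ)
  open import Function using (id; _∘_; mk⇔)
  open import Relation.Nullary using (¬_)
  open import Relation.Nullary.Decidable using (¬?)
  open import Relation.Binary.PropositionalEquality
  open Counting
  open Divisibility
  open Forms
  open FormsModPrime ℓ-prime ℓ≢2 ℓ≢3
  open Rationals
  open PrimeModulus ℓ-prime

  #-roots-Cp[t,1] : #[ t < ℓ ] (+ ℓ ℤ.∣? Cp (+ t) 1ℤ) ≡ r ℓ
  #-roots-Cp[t,1] = trans
    (#-cong _ _ ℓ (λ t _ → mk⇔ (∣⇒∣ᵤ ∘ subst (+ ℓ ℤ.∣_) (sym (pos-Cp t))) (subst (+ ℓ ℤ.∣_) (pos-Cp t) ∘ ∣ᵤ⇒∣)))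
    (sym (length-filter-applyUpTo (λ t → ℓ ∣? (t ^ 4 + 36 * t ^ 2 + 432)) id ℓ))

  module _ {a : ℕ} (ℓ∤a : ¬ ℓ ∣ a) where

    ℓ∤+a : ¬ + ℓ ℤ.∣ + a
    ℓ∤+a = ℓ∤a ∘ ∣⇒∣ᵤ

    simple-roots : ∀ y → + ℓ ℤ.∣ Cp (+ a) y → ¬ + ℓ ℤ.∣ ∂C (+ a) y
    simple-roots y = ∤a∧∣Cp⇒∤∂C ℓ∤+a

    open Hensel.Lifting ℓ-prime (Cp (+ a)) (∂C (+ a)) (Cp-remainder (+ a)) (Cp-taylor (+ a)) simple-roots

    #-roots-Cp : #[ b < ℓ ^ 6 ] (+ (ℓ ^ 4) ℤ.∣? Cp (+ a) (+ b)) ≡ ℓ ^ 2 * r ℓ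
    #-roots-Cp = begin
      #[ b < ℓ ^ 6 ] (+ (ℓ ^ 4) ℤ.∣? Cp (+ a) (+ b))
        ≡⟨ cong (λ n → #[ b < n ] (+ (ℓ ^ 4) ℤ.∣? Cp (+ a) (+ b))) (ℕ.^-distribˡ-+-* ℓ 2 4) ⟩
      #[ b < ℓ ^ 2 * ℓ ^ 4 ] (+ (ℓ ^ 4) ℤ.∣? Cp (+ a) (+ b))  ≡⟨ #-roots-periodic (ℓ ^ 2) (ℓ ^ 4) ⟩
      ℓ ^ 2 * #[ b < ℓ ^ 4 ] (+ (ℓ ^ 4) ℤ.∣? Cp (+ a) (+ b))  ≡⟨ cong (ℓ ^ 2 *_) (#-roots-mod-p^ 3) ⟩
      ℓ ^ 2 * #[ b < ℓ ] (+ ℓ ℤ.∣? Cp (+ a) (+ b))            ≡⟨ cong (ℓ ^ 2 *_) (#-roots-dehomogenise ℓ∤+a) ⟩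
      ℓ ^ 2 * #[ t < ℓ ] (+ ℓ ℤ.∣? Cp (+ t) 1ℤ)               ≡⟨ cong (ℓ ^ 2 *_) #-roots-Cp[t,1] ⟩
      ℓ ^ 2 * r ℓ                                            ∎
      where open ≡-Reasoning

    #-bad-unit : #[ b < ℓ ^ 6 ] ¬? (good? ℓ (a , b)) ≡ ℓ ^ 2 * r ℓ
    #-bad-unit = trans
      (#-¬-cong (λ b → good? ℓ (a , b)) (λ b → + (ℓ ^ 4) ℤ.∣? Cp (+ a) (+ b)) (ℓ ^ 6) (λ b _ → Good⇔∤Cp ℓ∤a))
      #-roots-Cp

  #-bad-multiple : ∀ {a} → ℓ ∣ a → #[ b < ℓ ^ 6 ] ¬? (good? ℓ (a , b)) ≡ ℓ ^ 5
  #-bad-multiple {a} ℓ∣a = begin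
    #[ b < ℓ ^ 6 ] ¬? (good? ℓ (a , b))  ≡⟨ #-¬-cong (λ b → good? ℓ (a , b)) (ℓ ∣?_) (ℓ ^ 6) (λ b _ → Good⇔∤b ℓ∣a) ⟩
    #[ b < ℓ * ℓ ^ 5 ] (ℓ ∣? b)         ≡⟨ cong (λ n → #[ b < n ] (ℓ ∣? b)) (ℕ.*-comm ℓ (ℓ ^ 5)) ⟩
    #[ b < ℓ ^ 5 * ℓ ] (ℓ ∣? b)         ≡⟨ #-multiples (ℓ ^ 5) ℓ ⟩
    ℓ ^ 5                               ∎
    where open ≡-Reasoning

  #-bad : ℕ → ℕ
  #-bad a = #[ b < ℓ ^ 6 ] ¬? (good? ℓ (a , b))

  count+∑#-bad : count ℓ + ∑[ a < ℓ ^ 6 ] #-bad a ≡ ℓ ^ 6 * ℓ ^ 6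
  count+∑#-bad = begin
    count ℓ + ∑[ a < N ] #-bad a                     ≡⟨ cong (_+ ∑[ a < N ] #-bad a) (length-filter-cartesianProduct (good? ℓ) id N N) ⟩
    ∑[ a < N ] #-good a + ∑[ a < N ] #-bad a         ≡⟨ ∑-distrib-+ N #-good #-bad ⟨
    ∑[ a < N ] (#-good a + #-bad a)                  ≡⟨ ∑-cong N (λ a _ → #-+-#-¬ (λ b → good? ℓ (a , b)) N) ⟩
    ∑[ a < N ] N                                     ≡⟨ ∑-const N N ⟩
    N * N                                            ∎
    where
    open ≡-Reasoning
    N : ℕ
    N = ℓ ^ 6
    #-good : ℕ → ℕ
    #-good a = #[ b < N ] good? ℓ (a , b)

  #-multiples-of-ℓ : #[ a < ℓ ^ 6 ] (ℓ ∣? a) ≡ ℓ ^ 5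
  #-multiples-of-ℓ = trans (cong (λ n → #[ a < n ] (ℓ ∣? a)) (ℕ.*-comm ℓ (ℓ ^ 5))) (#-multiples (ℓ ^ 5) ℓ)

  #-units : #[ a < ℓ ^ 6 ] ¬? (ℓ ∣? a) ≡ ℓ ^ 5 * (ℓ ∸ 1)
  #-units = begin
    U                          ≡⟨ ℕ.m+n∸m≡n (ℓ ^ 5) U ⟨
    ℓ ^ 5 + U ∸ ℓ ^ 5          ≡⟨ cong (λ n → n + U ∸ ℓ ^ 5) #-multiples-of-ℓ ⟨
    #[ a < ℓ ^ 6 ] (ℓ ∣? a) + U ∸ ℓ ^ 5 ≡⟨ cong (_∸ ℓ ^ 5) (#-+-#-¬ (ℓ ∣?_) (ℓ ^ 6)) ⟩
    ℓ * ℓ ^ 5 ∸ ℓ ^ 5          ≡⟨ cong₂ _∸_ (ℕ.*-comm ℓ (ℓ ^ 5)) (sym (ℕ.*-identityʳ (ℓ ^ 5))) ⟩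
    ℓ ^ 5 * ℓ ∸ ℓ ^ 5 * 1      ≡⟨ ℕ.*-distribˡ-∸ (ℓ ^ 5) ℓ 1 ⟨
    ℓ ^ 5 * (ℓ ∸ 1)            ∎
    where
    open ≡-Reasoning
    U : ℕ
    U = #[ a < ℓ ^ 6 ] ¬? (ℓ ∣? a)

  ∑#-bad : ∑[ a < ℓ ^ 6 ] #-bad a ≡ ℓ ^ 5 * ℓ ^ 5 + ℓ ^ 2 * r ℓ * (ℓ ^ 5 * (ℓ ∸ 1))
  ∑#-bad = begin
    ∑[ a < ℓ ^ 6 ] #-bad a
      ≡⟨ ∑-by-cases (ℓ ∣?_) (ℓ ^ 6) #-bad (ℓ ^ 5) (ℓ ^ 2 * r ℓ) (λ a _ → #-bad-multiple) (λ a _ → #-bad-unit) ⟩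
    ℓ ^ 5 * #[ a < ℓ ^ 6 ] (ℓ ∣? a) + ℓ ^ 2 * r ℓ * #[ a < ℓ ^ 6 ] ¬? (ℓ ∣? a)
      ≡⟨ cong₂ (λ m u → ℓ ^ 5 * m + ℓ ^ 2 * r ℓ * u) #-multiples-of-ℓ #-units ⟩
    ℓ ^ 5 * ℓ ^ 5 + ℓ ^ 2 * r ℓ * (ℓ ^ 5 * (ℓ ∸ 1)) ∎
    where open ≡-Reasoning

  𝔡-cross-multiplied : count ℓ * (ℓ ^ 2 * ℓ ^ 5) + ℓ ^ 12 * ℓ ^ 5 + ℓ ^ 12 * ℓ ^ 2 * (r ℓ * (ℓ ∸ 1)) ≡
                       ℓ ^ 12 * (ℓ ^ 2 * ℓ ^ 5)
  𝔡-cross-multiplied = begin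
    count ℓ * (ℓ ^ 2 * ℓ ^ 5) + ℓ ^ 12 * ℓ ^ 5 + ℓ ^ 12 * ℓ ^ 2 * (r ℓ * (ℓ ∸ 1))
      ≡⟨ factor (count ℓ) ℓ (r ℓ) (ℓ ∸ 1) ⟩
    (count ℓ + (ℓ ^ 5 * ℓ ^ 5 + ℓ ^ 2 * r ℓ * (ℓ ^ 5 * (ℓ ∸ 1)))) * (ℓ ^ 2 * ℓ ^ 5)
      ≡⟨ cong (λ n → (count ℓ + n) * (ℓ ^ 2 * ℓ ^ 5)) ∑#-bad ⟨
    (count ℓ + ∑[ a < ℓ ^ 6 ] #-bad a) * (ℓ ^ 2 * ℓ ^ 5)
      ≡⟨ cong (_* (ℓ ^ 2 * ℓ ^ 5)) count+∑#-bad ⟩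
    ℓ ^ 6 * ℓ ^ 6 * (ℓ ^ 2 * ℓ ^ 5)
      ≡⟨ solve 1 (λ ℓ → ℓ :^ 6 :* ℓ :^ 6 :* (ℓ :^ 2 :* ℓ :^ 5) := ℓ :^ 12 :* (ℓ :^ 2 :* ℓ :^ 5)) refl ℓ ⟩
    ℓ ^ 12 * (ℓ ^ 2 * ℓ ^ 5) ∎
    where
    open ≡-Reasoning
    open +-*-Solver
    factor : ∀ c ℓ r m → c * (ℓ ^ 2 * ℓ ^ 5) + ℓ ^ 12 * ℓ ^ 5 + ℓ ^ 12 * ℓ ^ 2 * (r * m) ≡
                         (c + (ℓ ^ 5 * ℓ ^ 5 + ℓ ^ 2 * r * (ℓ ^ 5 * m))) * (ℓ ^ 2 * ℓ ^ 5)
    factor = solve 4 (λ c ℓ r m →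
      c :* (ℓ :^ 2 :* ℓ :^ 5) :+ ℓ :^ 12 :* ℓ :^ 5 :+ ℓ :^ 12 :* ℓ :^ 2 :* (r :* m)
      := (c :+ (ℓ :^ 5 :* ℓ :^ 5 :+ ℓ :^ 2 :* r :* (ℓ :^ 5 :* m))) :* (ℓ :^ 2 :* ℓ :^ 5)) refl

  𝔡≡rhs : 𝔡 ℓ ≡ rhs ℓ
  𝔡≡rhs = c/d≡1-1/p-R/q (count ℓ) (r ℓ * (ℓ ∸ 1)) (ℓ ^ 12) (ℓ ^ 2) (ℓ ^ 5)
            {{ℕ.m^n≢0 ℓ 12}} {{ℕ.m^n≢0 ℓ 2}} {{ℕ.m^n≢0 ℓ 5}} 𝔡-cross-multiplied

lemma4p2 : ((ℓ : ℕ) → .{{_ : NonZero ℓ}} → Prime ℓ → ℓ ≢ 2 → ℓ ≢ 3 → 𝔡 ℓ ≡ rhs ℓ)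
    × (𝔡 2 ≡ (+ 1) / 2)
    × (𝔡 3 ≡ (+ 2) / 3)
lemma4p2 = (λ ℓ ℓ-prime ℓ≢2 ℓ≢3 → DensityFormula.𝔡≡rhs ℓ-prime ℓ≢2 ℓ≢3) , refl , refl
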